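{- Let $S=\{n_1,n_2,\ldots,n_s\}$ be a set of integers with $2\le n_s<\cdots<n_2<n_1$. Let $\delta(S)$ be the minimum number of vertices of a mixed hypergraph that is a one-realization of $S$, and $\delta_{\mathcal C}(S)$ the minimum number of $\mathcal C$-edges of a mixed hypergraph that is a one-realization of $S$. Then $\delta_{\mathcal C}(S)\ge \delta(S)-n_s$ if $n_s+1\notin S$, and $\delta_{\mathcal C}(S)\ge\delta(S)-n_s-1$ if $n_s+1\in S$.
   Context: A mixed hypergraph is a triple $\mathcal H=(X,\mathcal C,\mathcal D)$ where $X$ is a finite set and $\mathcal C,\mathcal D$ are families of subsets of $X$, called $\mathcal C$-edges and $\mathcal D$-edges. A proper $k$-coloring of $\mathcal H$ is a map from $X$ to a set of $k$ colors such that every $\mathcal C$-edge contains two vertices of a common color and every $\mathcal D$-edge contains two vertices of distinct colors; it is strict if all $k$ colors are used. Colorings are identified with the partitions of $X$ into color classes. The feasible set $\mathcal F(\mathcal H)$ is the set of all $k$ such that $\mathcal H$ has a strict $k$-coloring; for $k\in\mathcal F(\mathcal H)$, $r_k$ is the number of partitions of $X$ arising as strict $k$-colorings. $\mathcal H$ is a one-realization of a set $S$ of positive integers if $\mathcal F(\mathcal H)=S$ and $r_k=1$ for every $k\in S$. -}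

module Defs where

open import Data.Nat using (ℕ; _≤_)
open import Data.Fin using (Fin)
open import Data.Fin.Subset using (Subset; _∈_)
open import Data.List using (List; length)
open import Data.Product using (Σ; ∃; _×_)
open import Relation.Binary.PropositionalEquality using (_≡_; _≢_)
open import Function using (_⇔_)
import Data.List.Membership.Propositional as LM

record MixedHypergraph : Set where
  field
    n : ℕ
    C : List (Subset n)
    D : List (Subset n)

open MixedHypergraph public

Coloring : MixedHypergraph → ℕ → Set
Coloring H k = Fin (n H) → Fin k

CEdgeOK : ∀ {m k} → (Fin m → Fin k) → Subset m → Set
CEdgeOK {m} c E = Σ (Fin m) λ x → Σ (Fin m) λ y → x ≢ y × x ∈ E × y ∈ E × c x ≡ c y

DEdgeOK : ∀ {m k} → (Fin m → Fin k) → Subset m → Set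
DEdgeOK {m} c E = Σ (Fin m) λ x → Σ (Fin m) λ y → x ∈ E × y ∈ E × c x ≢ c y

Proper : (H : MixedHypergraph) {k : ℕ} → Coloring H k → Set
Proper H c = (∀ E → E LM.∈ C H → CEdgeOK c E) × (∀ E → E LM.∈ D H → DEdgeOK c E)

Strict : (H : MixedHypergraph) {k : ℕ} → Coloring H k → Set
Strict H {k} c = (i : Fin k) → ∃ λ x → c x ≡ i

StrictProper : (H : MixedHypergraph) {k : ℕ} → Coloring H k → Set
StrictProper H c = Strict H c × Proper H c

SamePartition : (H : MixedHypergraph) {k l : ℕ} → Coloring H k → Coloring H l → Set
SamePartition H c c' = ∀ x y → (c x ≡ c y) ⇔ (c' x ≡ c' y)

Feasible : MixedHypergraph → ℕ → Set
Feasible H k = ∃ λ (c : Coloring H k) → StrictProper H c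

-- H is a one-realization of S (S given as a list, read as the set of its elements):
-- F(H) = S, and r_k = 1 for all k ∈ S
OneRealization : MixedHypergraph → List ℕ → Set
OneRealization H S =
  (∀ k → Feasible H k ⇔ k LM.∈ S) ×
  (∀ k → k LM.∈ S → (c c' : Coloring H k) →
      StrictProper H c → StrictProper H c' → SamePartition H c c')

IsMinimum : (ℕ → Set) → ℕ → Set
IsMinimum P d = P d × (∀ m → P m → d ≤ m)

IsDelta : List ℕ → ℕ → Set
IsDelta S = IsMinimum λ v → ∃ λ H → OneRealization H S × n H ≡ v

IsDeltaC : List ℕ → ℕ → Set
IsDeltaC S = IsMinimum λ e → ∃ λ H → OneRealization H S × length (C H) ≡ e

module Submission where

-- Let c be a strict proper n_s-colouring of a one-realization H. Choosing in
-- every C-edge two vertices of equal c-colour and joining them, the resulting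
-- graph has at least |X| - |C| components. Any partition into unions of these
-- components that still refines c is again a strict proper colouring. If there
-- were more than n_s components (resp. n_s + 1), merging components of equal
-- c-colour would produce a strict colouring with n_s + 1 colours (resp. two
-- different partitions with n_s + 1 classes), contradicting F(H) = S (resp.
-- r_{n_s+1} = 1). Hence |X| ≤ |C| + n_s (resp. |C| + n_s + 1).

open import Defs
open import Data.Nat using (ℕ; zero; suc; _≤_; _∸_; _+_; s≤s)
open import Data.Nat.Properties
  using (≤-refl; ≤-trans; ≤-reflexive; n≤1+n; +-suc; +-comm; +-monoʳ-≤; m≤n⇒m<n∨m≡n; m≤n+o⇒m∸n≤o; _≤?_; ≰⇒>)
open import Data.List using (List; []; _∷_; length)
open import Data.List.Membership.Propositional using (_∈_; _∉_)
open import Data.List.Relation.Unary.Any using (here; there)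
open import Data.Product using (Σ; _×_; _,_; proj₁; proj₂)
open import Data.Sum using (inj₁; inj₂)
open import Data.Empty using (⊥-elim)
open import Data.Fin using (Fin; punchIn; punchOut)
open import Data.Fin.Properties
  using (_≟_; punchOut-cong; punchOut-injective; punchOut-punchIn; punchIn-punchOut; punchInᵢ≢i; punchIn-injective; pigeonhole; <⇒≢)
open import Data.Fin.Subset using (Subset)
open import Function using (_∘_; Equivalence)
open import Function.Definitions using (StrictlySurjective)
open import Relation.Nullary using (¬_; yes; no)
open import Relation.Binary.PropositionalEquality using (_≡_; _≢_; refl; sym; trans; cong; subst)

glue : ∀ {K} (i j : Fin (suc K)) → i ≢ j → Fin (suc K) → Fin K
glue i j i≢j a with j ≟ a
... | yes _   = punchOut (i≢j ∘ sym)
... | no j≢a = punchOut j≢a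

glue-identifies : ∀ {K} (i j : Fin (suc K)) (i≢j : i ≢ j) → glue i j i≢j i ≡ glue i j i≢j j
glue-identifies i j i≢j with j ≟ i | j ≟ j
... | yes j≡i | _       = ⊥-elim (i≢j (sym j≡i))
... | no _    | yes _   = punchOut-cong j refl
... | no _    | no j≢j = ⊥-elim (j≢j refl)

glue-injective-outside : ∀ {K} {i j : Fin (suc K)} (i≢j : i ≢ j) {a b} → b ≢ i → b ≢ j →
  glue i j i≢j a ≡ glue i j i≢j b → a ≡ b
glue-injective-outside {j = j} i≢j {a} {b} b≢i b≢j eq with j ≟ a | j ≟ b
... | _        | yes j≡b = ⊥-elim (b≢j (sym j≡b))
... | yes refl | no j≢b  = ⊥-elim (b≢i (sym (punchOut-injective _ j≢b eq)))
... | no j≢a   | no j≢b  = punchOut-injective j≢a j≢b eq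

glue-punchIn : ∀ {K} (i j : Fin (suc K)) (i≢j : i ≢ j) t → glue i j i≢j (punchIn j t) ≡ t
glue-punchIn i j i≢j t with j ≟ punchIn j t
... | yes j≡ = ⊥-elim (punchInᵢ≢i j t (sym j≡))
... | no _   = trans (punchOut-cong j refl) (punchOut-punchIn j)

punchIn-glue : ∀ {K} {A : Set} (f : Fin (suc K) → A) (i j : Fin (suc K)) (i≢j : i ≢ j) →
  f i ≡ f j → ∀ a → f (punchIn j (glue i j i≢j a)) ≡ f a
punchIn-glue f i j i≢j fi≡fj a with j ≟ a
... | yes refl = trans (cong f (punchIn-punchOut _)) fi≡fj
... | no j≢a   = cong f (punchIn-punchOut j≢a)

CEdgeOK-map : ∀ {m k l} {c : Fin m → Fin k} {E} (g : Fin k → Fin l) → CEdgeOK c E → CEdgeOK (g ∘ c) E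
CEdgeOK-map g (x , y , x≢y , x∈E , y∈E , cx≡cy) = x , y , x≢y , x∈E , y∈E , cong g cx≡cy

record Refinement {n k : ℕ} (L : List (Subset n)) (c : Fin n → Fin k) (K : ℕ) : Set where
  field
    class             : Fin n → Fin K
    colour            : Fin K → Fin k
    class-surjective  : StrictlySurjective _≡_ class
    colour∘class      : ∀ x → colour (class x) ≡ c x
    class-satisfies-C : ∀ E → E ∈ L → CEdgeOK class E

open Refinement

module _ {n k : ℕ} {c : Fin n → Fin k} where

  discrete : Refinement [] c n
  discrete = record
    { class             = λ x → x
    ; colour            = c
    ; class-surjective  = λ x → x , refl
    ; colour∘class      = λ _ → refl
    ; class-satisfies-C = λ _ ()
    }

  class-refines : ∀ {L K} (R : Refinement L c K) x y → class R x ≡ class R y → c x ≡ c y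
  class-refines R x y eq = trans (sym (colour∘class R x)) (trans (cong (colour R) eq) (colour∘class R y))

  addEdge : ∀ {L K E} (R : Refinement L c K) → CEdgeOK (class R) E → Refinement (E ∷ L) c K
  addEdge R ok = record
    { class             = class R
    ; colour            = colour R
    ; class-surjective  = class-surjective R
    ; colour∘class      = colour∘class R
    ; class-satisfies-C = λ { _ (here refl) → ok ; E (there E∈L) → class-satisfies-C R E E∈L }
    }

  glueClasses : ∀ {L K} (R : Refinement L c (suc K)) (i j : Fin (suc K)) (i≢j : i ≢ j) →
    colour R i ≡ colour R j → Refinement L c K
  glueClasses R i j i≢j same = record
    { class             = glue i j i≢j ∘ class R
    ; colour            = colour R ∘ punchIn j
    ; class-surjective  = surjective
    ; colour∘class      = λ x → trans (punchIn-glue (colour R) i j i≢j same (class R x)) (colour∘class R x)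
    ; class-satisfies-C = λ E E∈L → CEdgeOK-map (glue i j i≢j) (class-satisfies-C R E E∈L)
    }
    where
    surjective : StrictlySurjective _≡_ (glue i j i≢j ∘ class R)
    surjective t with class-surjective R (punchIn j t)
    ... | x , eq = x , trans (cong (glue i j i≢j) eq) (glue-punchIn i j i≢j t)

  satisfyEdge : ∀ {L K E} → Refinement L c K → CEdgeOK c E →
    Σ ℕ λ K′ → Refinement (E ∷ L) c K′ × K ≤ suc K′
  satisfyEdge {K = zero} R (x , _) with class R x
  ... | ()
  satisfyEdge {K = suc K} R (x , y , x≢y , x∈E , y∈E , cx≡cy) with class R x ≟ class R y
  ... | yes eq = suc K , addEdge R (x , y , x≢y , x∈E , y∈E , eq) , n≤1+n (suc K)
  ... | no neq = K , addEdge R′ (x , y , x≢y , x∈E , y∈E , glue-identifies _ _ neq) , ≤-refl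
    where
    R′ : Refinement _ c K
    R′ = glueClasses R (class R x) (class R y) neq
           (trans (colour∘class R x) (trans cx≡cy (sym (colour∘class R y))))

  componentRefinement : ∀ L → (∀ E → E ∈ L → CEdgeOK c E) →
    Σ ℕ λ K → Refinement L c K × n ≤ length L + K
  componentRefinement [] _ = n , discrete , ≤-refl
  componentRefinement (E ∷ L) c-satisfies with componentRefinement L (λ E′ → c-satisfies E′ ∘ there)
  ... | K , R , n≤ with satisfyEdge R (c-satisfies E (here refl))
  ...   | K′ , R′ , K≤ =
    K′ , R′ , ≤-trans n≤ (≤-trans (+-monoʳ-≤ (length L) K≤) (≤-reflexive (+-suc (length L) K′)))

  coarsen : ∀ {L K t} → Refinement L c K → k ≤ t → t ≤ K → Refinement L c t
  coarsen R k≤t t≤K with m≤n⇒m<n∨m≡n t≤K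
  ... | inj₂ refl = R
  ... | inj₁ (s≤s t≤K′) with pigeonhole (s≤s (≤-trans k≤t t≤K′)) (colour R)
  ...   | i , j , i<j , same = coarsen (glueClasses R i j (<⇒≢ i<j) same) k≤t t≤K′

  ambiguousGluing : ∀ {L m} → k ≤ m → Refinement L c (suc (suc m)) →
    Σ (Refinement L c (suc m)) λ R₁ → Σ (Refinement L c (suc m)) λ R₂ →
    Σ (Fin n) λ x → Σ (Fin n) λ y → class R₁ x ≡ class R₁ y × class R₂ x ≢ class R₂ y
  ambiguousGluing {m = m} k≤m R with pigeonhole (s≤s (≤-trans k≤m (n≤1+n m))) (colour R)
  ... | i , j , i<j , same with pigeonhole (s≤s k≤m) (colour R ∘ punchIn j)
  ...   | i′ , j′ , i′<j′ , same′ =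
    glueClasses R i j i≢j same , glueClasses R a b a≢b same′ , x , y , glued , separated
    where
    i≢j = <⇒≢ i<j
    a = punchIn j i′
    b = punchIn j j′
    a≢b : a ≢ b
    a≢b = <⇒≢ i′<j′ ∘ punchIn-injective j i′ j′
    x = proj₁ (class-surjective R i)
    y = proj₁ (class-surjective R j)
    x↦i = proj₂ (class-surjective R i)
    y↦j = proj₂ (class-surjective R j)
    glued : glue i j i≢j (class R x) ≡ glue i j i≢j (class R y)
    glued = trans (cong (glue i j i≢j) x↦i) (trans (glue-identifies i j i≢j) (cong (glue i j i≢j) (sym y↦j)))
    -- Neither a nor b is j, so the second gluing keeps the class of y apart.
    separated : glue a b a≢b (class R x) ≢ glue a b a≢b (class R y)
    separated eq = i≢j (trans (sym x↦i) (trans (glue-injective-outside a≢b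
      (subst (_≢ a) (sym y↦j) (punchInᵢ≢i j i′ ∘ sym))
      (subst (_≢ b) (sym y↦j) (punchInᵢ≢i j j′ ∘ sym)) eq) y↦j))

module _ (H : MixedHypergraph) {k : ℕ} {c : Coloring H k} (c-proper : Proper H c) where

  refinement-strictProper : ∀ {K} (R : Refinement (C H) c K) → StrictProper H (class R)
  refinement-strictProper R = class-surjective R , class-satisfies-C R , D-ok
    where
    D-ok : ∀ E → E ∈ D H → DEdgeOK (class R) E
    D-ok E E∈D with proj₂ c-proper E E∈D
    ... | x , y , x∈E , y∈E , cx≢cy = x , y , x∈E , y∈E , cx≢cy ∘ class-refines R x y

  vertices≤C+t : ∀ t → k ≤ t → ¬ Refinement (C H) c (suc t) → n H ≤ length (C H) + t
  vertices≤C+t t k≤t no-refinement with componentRefinement (C H) (proj₁ c-proper)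
  ... | K , R , n≤ with K ≤? t
  ...   | yes K≤t = ≤-trans n≤ (+-monoʳ-≤ (length (C H)) K≤t)
  ...   | no K≰t  = ⊥-elim (no-refinement (coarsen R (≤-trans k≤t (n≤1+n t)) (≰⇒> K≰t)))

module _ {H : MixedHypergraph} {S : List ℕ} (H-realizes : OneRealization H S) {ns : ℕ} (ns∈S : ns ∈ S) where

  private
    ns-colouring : Feasible H ns
    ns-colouring = Equivalence.from (proj₁ H-realizes ns) ns∈S

    c-proper : Proper H (proj₁ ns-colouring)
    c-proper = proj₂ (proj₂ ns-colouring)

    strictProper = refinement-strictProper H c-proper

  vertices≤C+ns : suc ns ∉ S → n H ≤ length (C H) + ns
  vertices≤C+ns ns+1∉S = vertices≤C+t H c-proper ns ≤-refl λ R →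
    ns+1∉S (Equivalence.to (proj₁ H-realizes (suc ns)) (class R , strictProper R))

  vertices≤C+ns+1 : suc ns ∈ S → n H ≤ length (C H) + suc ns
  vertices≤C+ns+1 ns+1∈S = vertices≤C+t H c-proper (suc ns) (n≤1+n ns) λ R →
    let (R₁ , R₂ , x , y , glued , separated) = ambiguousGluing ≤-refl R
        same = proj₂ H-realizes (suc ns) ns+1∈S (class R₁) (class R₂) (strictProper R₁) (strictProper R₂)
    in separated (Equivalence.to (same x y) glued)

lemma3p2 : (S : List ℕ) (ns : ℕ) → 2 ≤ ns → ns ∈ S → (∀ k → k ∈ S → ns ≤ k) →
    (d dC : ℕ) → IsDelta S d → IsDeltaC S dC →
    (suc ns ∉ S → d ∸ ns ≤ dC) × (suc ns ∈ S → d ∸ suc ns ≤ dC)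
lemma3p2 S ns _ ns∈S _ d dC (_ , d-minimal) ((H , H-realizes , |C|≡dC) , _) =
  (λ ns+1∉S → δ∸t≤δC (vertices≤C+ns H-realizes ns∈S ns+1∉S)) ,
  (λ ns+1∈S → δ∸t≤δC (vertices≤C+ns+1 H-realizes ns∈S ns+1∈S))
  where
  d≤n : d ≤ n H
  d≤n = d-minimal (n H) (H , H-realizes , refl)

  δ∸t≤δC : ∀ {t} → n H ≤ length (C H) + t → d ∸ t ≤ dC
  δ∸t≤δC {t} n≤ = m≤n+o⇒m∸n≤o d t
    (subst (λ e → d ≤ t + e) |C|≡dC (≤-trans d≤n (≤-trans n≤ (≤-reflexive (+-comm (length (C H)) t)))))
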